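{- Let $\epsilon>0$, let $G$ be a graph and $\mu$ a mass on $G$ such that (1) $\mu(\{v\})<\epsilon$ for every vertex $v$; (2) $\mu(N(v))<\epsilon$ for every vertex $v$; and (3) there do not exist two anticomplete sets $A,B\subseteq V(G)$ with $\mu(A),\mu(B)\ge\epsilon$. Let $X\subseteq Y\subseteq V(G)$ with $\mu(X)\ge 3\epsilon$. Then the big piece of $X$ is a subset of the big piece of $Y$.
   Context: All graphs are finite and simple. A mass on $G$ is a function assigning a real number $\mu(X)$ to every $X\subseteq V(G)$ such that $\mu(\emptyset)=0$, $\mu(V(G))=1$, $\mu(X)\le\mu(Y)$ whenever $X\subseteq Y$, and $\mu(X\cup Y)\le \mu(X)+\mu(Y)$ for all disjoint $X,Y$. $N(v)$ is the set of neighbours of $v$; two sets are anticomplete if they are disjoint with no edge between them. Under the hypotheses (1)–(3), for every $X\subseteq V(G)$ with $\mu(X)\ge 3\epsilon$ there is a unique component of $G[X]$ whose vertex set $X'$ satisfies $\mu(X')>\mu(X)-\epsilon$; this $X'$ is called the big piece of $X$. -}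

module Defs where

open import Level using (0ℓ)
open import Data.Nat using (ℕ)
open import Data.Bool using (Bool; true; false)
open import Data.Fin using (Fin)
open import Data.Fin.Subset using (Subset; _∈_; _∉_; _⊆_; ⊥; ⊤; _∪_; Nonempty)
open import Data.Vec using (tabulate)
open import Data.Product using (Σ; ∃; _×_; _,_)
open import Relation.Nullary using (¬_)
open import Relation.Binary.PropositionalEquality using (_≡_)
open import Relation.Binary.Structures using (IsDecTotalOrder)
open import Algebra.Structures using (IsCommutativeRing)

-- The real numbers, axiomatised as a complete ordered field
-- (unique up to isomorphism, classically).
record RealField : Set₁ where
  infixl 6 _+_ _-_
  infixl 7 _*_
  infix 4 _≤_ _<_
  field
    ℝ : Set
    0r 1r : ℝ
    _+_ _*_ : ℝ → ℝ → ℝ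
    -_ : ℝ → ℝ
    _≤_ : ℝ → ℝ → Set
    isCommutativeRing : IsCommutativeRing _≡_ _+_ _*_ -_ 0r 1r
    isDecTotalOrder : IsDecTotalOrder _≡_ _≤_
    +-mono-≤ : ∀ {x y} z → x ≤ y → x + z ≤ y + z
    *-nonneg : ∀ {x y} → 0r ≤ x → 0r ≤ y → 0r ≤ x * y
    0≢1 : ¬ (0r ≡ 1r)
    inverse : ∀ x → ¬ (x ≡ 0r) → Σ ℝ (λ y → x * y ≡ 1r)
    complete : (P : ℝ → Set) → ∃ P → (∃ λ b → ∀ x → P x → x ≤ b) →
               ∃ λ s → (∀ x → P x → x ≤ s) × (∀ b → (∀ x → P x → x ≤ b) → s ≤ b)

  _<_ : ℝ → ℝ → Set
  x < y = (x ≤ y) × ¬ (x ≡ y)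

  _-_ : ℝ → ℝ → ℝ
  x - y = x + (- y)

record Graph (n : ℕ) : Set where
  field
    adj : Fin n → Fin n → Bool
    adj-sym : ∀ u v → adj u v ≡ adj v u
    adj-irrefl : ∀ v → adj v v ≡ false

Disjoint : {n : ℕ} → Subset n → Subset n → Set
Disjoint A B = ∀ x → x ∈ A → x ∉ B

module _ {n : ℕ} (G : Graph n) where
  open Graph G

  Adj : Fin n → Fin n → Set
  Adj u v = adj u v ≡ true

  N : Fin n → Subset n
  N v = tabulate (adj v)

  Anticomplete : Subset n → Subset n → Set
  Anticomplete A B = Disjoint A B × (∀ a b → a ∈ A → b ∈ B → ¬ Adj a b)

  data PathIn (S : Subset n) : Fin n → Fin n → Set where
    here : ∀ {v} → v ∈ S → PathIn S v v
    step : ∀ {u w v} → u ∈ S → Adj u w → PathIn S w v → PathIn S u v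

  Connected : Subset n → Set
  Connected S = Nonempty S × (∀ u v → u ∈ S → v ∈ S → PathIn S u v)

  IsComponent : Subset n → Subset n → Set
  IsComponent X C = C ⊆ X × Connected C ×
                    (∀ u v → u ∈ C → v ∈ X → Adj u v → v ∈ C)

module _ (R : RealField) {n : ℕ} where
  open RealField R

  record IsMass (μ : Subset n → ℝ) : Set where
    field
      empty : μ ⊥ ≡ 0r
      full : μ ⊤ ≡ 1r
      mono : ∀ X Y → X ⊆ Y → μ X ≤ μ Y
      subadd : ∀ X Y → Disjoint X Y → μ (X ∪ Y) ≤ μ X + μ Y

module Submission where

-- The big piece X' of X is a connected subset of Y, and the big piece Y' of
-- Y is a component of G[Y].  A connected subset of Y either lies inside a
-- given component of G[Y] or misses it entirely, and in the second case it
-- is anticomplete to that component (an edge leaving a component inside Y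
-- would enlarge it).  So if X' ⊈ Y', then X' and Y' are anticomplete.  Both
-- are heavy: from μ(X) ≥ 3ε and μ(Z) - ε < μ(Z') one gets μ(Z') ≥ ε for
-- Z = X and, using μ(Y) ≥ μ(X), for Z = Y.  This contradicts hypothesis (3).
--
-- Hypotheses (1) and (2) are only
-- needed for the existence and uniqueness of big pieces, not for this step.

open import Defs
open import Data.Nat using (ℕ)
open import Data.Fin.Subset using (Subset; _⊆_; ⁅_⁆; _∈_)
open import Data.Fin.Subset.Properties using (_∈?_)
open import Data.Fin.Properties using (any?)
open import Data.Product using (Σ; _×_; _,_)
open import Data.Sum using (_⊎_; inj₁; inj₂)
open import Data.Empty using (⊥-elim)
open import Relation.Nullary using (¬_; yes; no)
open import Relation.Nullary.Decidable using (_×-dec_)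
open import Relation.Binary.PropositionalEquality using (_≡_; sym; cong)
  renaming (trans to ≡-trans)
open import Relation.Binary.Bundles using (DecTotalOrder)
open import Algebra.Structures using (IsCommutativeRing)

module Heavy (R : RealField) where
  open RealField R
  open IsCommutativeRing isCommutativeRing
    using (+-assoc; -‿inverseʳ; +-identityʳ; +-identityˡ)

  orderBundle : DecTotalOrder _ _ _
  orderBundle = record { isDecTotalOrder = isDecTotalOrder }

  open DecTotalOrder orderBundle public using () renaming (refl to ≤-refl)
  open import Relation.Binary.Reasoning.PartialOrder (DecTotalOrder.poset orderBundle)

  ≤-+nonneg : ∀ {y} x → 0r ≤ y → x ≤ y + x
  ≤-+nonneg {y} x 0≤y = begin
    x       ≡⟨ sym (+-identityˡ x) ⟩
    0r + x  ≤⟨ +-mono-≤ x 0≤y ⟩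
    y + x   ∎

  +-−-cancel : ∀ a b → (a + b) - b ≡ a
  +-−-cancel a b = begin-equality
    (a + b) - b    ≡⟨ +-assoc a b (- b) ⟩
    a + (b - b)    ≡⟨ cong (a +_) (-‿inverseʳ b) ⟩
    a + 0r         ≡⟨ +-identityʳ a ⟩
    a              ∎

  heavy : ∀ {ε b c} → ε + ε ≤ b → b - ε < c → ε ≤ c
  heavy {ε} {b} {c} 2ε≤b (b-ε≤c , _) = begin
    ε               ≡⟨ sym (+-−-cancel ε ε) ⟩
    (ε + ε) - ε     ≤⟨ +-mono-≤ (- ε) 2ε≤b ⟩
    b - ε           ≤⟨ b-ε≤c ⟩
    c               ∎

  -- A big piece of a set Z with μ(Z) ≥ 3ε has mass at least ε; here a is a
  -- lower bound for μ(Z) known to be at least 3ε.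
  bigPiece-heavy : ∀ {ε a b c} → 0r < ε →
                   ε + ε + ε ≤ a → a ≤ b → b - ε < c → ε ≤ c
  bigPiece-heavy {ε} {a} {b} (0≤ε , _) 3ε≤a a≤b =
    heavy (begin
      ε + ε        ≤⟨ ≤-+nonneg (ε + ε) 0≤ε ⟩
      ε + (ε + ε)  ≡⟨ sym (+-assoc ε ε ε) ⟩
      ε + ε + ε    ≤⟨ 3ε≤a ⟩
      a            ≤⟨ a≤b ⟩
      b            ∎)

module Components {n : ℕ} (G : Graph n) where

  pathStart : ∀ {S u v} → PathIn G S u v → u ∈ S
  pathStart (here u∈S)     = u∈S
  pathStart (step u∈S _ _) = u∈S

  component-closed : ∀ {Y C S} → IsComponent G Y C → S ⊆ Y →
                     ∀ {u v} → PathIn G S u v → u ∈ C → v ∈ C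
  component-closed compC S⊆Y (here _) u∈C = u∈C
  component-closed compC@(_ , _ , closed) S⊆Y (step _ u~w p) u∈C =
    component-closed compC S⊆Y p (closed _ _ u∈C (S⊆Y (pathStart p)) u~w)

  connected-meets⇒⊆ : ∀ {Y C D} → IsComponent G Y C → Connected G D → D ⊆ Y →
                      ∀ {x} → x ∈ D → x ∈ C → D ⊆ C
  connected-meets⇒⊆ compC (_ , paths) D⊆Y x∈D x∈C v∈D =
    component-closed compC D⊆Y (paths _ _ x∈D v∈D) x∈C

  -- A subset D of Y disjoint from a component C of G[Y] is anticomplete to C:
  -- an edge from D to C would put its endpoint in D into C.
  disjoint⇒anticomplete : ∀ {Y C D} → IsComponent G Y C → D ⊆ Y →
                          Disjoint D C → Anticomplete G D C
  disjoint⇒anticomplete (_ , _ , closed) D⊆Y disj =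
    disj , λ a b a∈D b∈C a~b →
      disj a a∈D (closed b a b∈C (D⊆Y a∈D)
                   (≡-trans (Graph.adj-sym G b a) a~b))

  connected⊆-or-anticomplete : ∀ {Y C D} → IsComponent G Y C →
                               Connected G D → D ⊆ Y →
                               D ⊆ C ⊎ Anticomplete G D C
  connected⊆-or-anticomplete {C = C} {D} compC connD D⊆Y
    with any? (λ x → (x ∈? D) ×-dec (x ∈? C))
  ... | yes (x , x∈D , x∈C) = inj₁ (connected-meets⇒⊆ compC connD D⊆Y x∈D x∈C)
  ... | no  noCommon        =
    inj₂ (disjoint⇒anticomplete compC D⊆Y λ x x∈D x∈C → noCommon (x , x∈D , x∈C))

mainTheorem6 : (R : RealField) → let open RealField R in
    (ε : ℝ) → 0r < ε →
    {n : ℕ} (G : Graph n) (μ : Subset n → ℝ) → IsMass R μ →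
    (∀ v → μ ⁅ v ⁆ < ε) →
    (∀ v → μ (N G v) < ε) →
    ¬ (Σ (Subset n) λ A → Σ (Subset n) λ B →
    Anticomplete G A B × (ε ≤ μ A) × (ε ≤ μ B)) →
    (X Y : Subset n) → X ⊆ Y → ε + ε + ε ≤ μ X →
    (X' Y' : Subset n) →
    IsComponent G X X' → μ X - ε < μ X' →
    IsComponent G Y Y' → μ Y - ε < μ Y' →
    X' ⊆ Y'
mainTheorem6 R ε 0<ε G μ mass _ _ noAnticomplete X Y X⊆Y 3ε≤μX X' Y'
             (X'⊆X , connX' , _) bigX' compY' bigY'
  with Components.connected⊆-or-anticomplete G compY' connX' (λ x∈X' → X⊆Y (X'⊆X x∈X'))
... | inj₁ X'⊆Y' = X'⊆Y'
... | inj₂ X'≁Y' = ⊥-elim (noAnticomplete (X' , Y' , X'≁Y' , heavyX' , heavyY'))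
  where
  open RealField R using (_≤_)
  open Heavy R using (bigPiece-heavy; ≤-refl)
  heavyX' : ε ≤ μ X'
  heavyX' = bigPiece-heavy 0<ε 3ε≤μX ≤-refl bigX'
  heavyY' : ε ≤ μ Y'
  heavyY' = bigPiece-heavy 0<ε 3ε≤μX (IsMass.mono mass X Y X⊆Y) bigY'
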